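{- Let $G=(V,E)$ be a trivalent $2$-edge-connected graph. Let $A\subseteq V$ be such that the induced subgraph $G[A]$ is connected, and let $v\in V- A$ be a vertex adjacent to some vertex of $A$. Then: (a) $r^*(\delta(A\cup\{v\}))\le r^*(\delta(A))+1$; (b) if $r^*(\delta(A\cup\{v\}))=r^*(\delta(A))+1$, then $r_{M_G}(A\cup\{v\})>r_{M_G}(A)$.
   Context: Graphs are finite and undirected and may have parallel edges; trivalent means every vertex has degree $3$. $r^*$ is the rank function of the bond (cographic) matroid of $G$, the dual of the cycle matroid. For $A\subseteq V$, $\delta(A)$ is the set of edges incident to at least one vertex of $A$. The graph curve matroid $M_G$ is the matroid on $V$ whose circuits are the non-empty subsets $A\subseteq V$ that are inclusion-minimal among non-empty subsets satisfying $r^*(\delta(A))\le|A|$. $r_{M_G}$ denotes its rank function. -}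

module Defs where

open import Data.Bool using (Bool; true; false; _∧_; _∨_; not; T; if_then_else_)
open import Data.Nat using (ℕ; zero; suc; _+_; _∸_; _⊔_; _≤ᵇ_; _<ᵇ_)
open import Data.Fin using (Fin; _<_)
open import Data.Fin.Subset using (Subset; inside; outside; ⁅_⁆; ∣_∣; _∈_; _─_; _-_; ⊤; _⊆_; _⊂_; Nonempty; _∪_)
open import Data.Fin.Subset.Properties using (_⊆?_; _⊂?_; nonempty?)
open import Data.Fin.Properties using (_≟_; _<?_)
open import Data.Vec using (Vec; []; _∷_; tabulate; lookup)
open import Data.List using (List; []; _∷_; [_]; map; _++_; foldr; allFin)
open import Data.Bool.ListAction using (any; all)
open import Data.Product using (_×_; ∃; Σ; _,_)
open import Data.Sum using (_⊎_)
open import Relation.Nullary.Decidable using (⌊_⌋)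
open import Relation.Binary.PropositionalEquality using (_≡_)

-- Finite undirected multigraphs: vertex set Fin n, edge set Fin m,
-- each edge e has two endpoints src e, tgt e (orientation irrelevant).

record Graph (n m : ℕ) : Set where
  field
    src : Fin m → Fin n
    tgt : Fin m → Fin n
open Graph public

module _ {n m : ℕ} (G : Graph n m) where

  incᵇ : Fin m → Fin n → Bool
  incᵇ e v = ⌊ src G e ≟ v ⌋ ∨ ⌊ tgt G e ≟ v ⌋

  countᵇ : ∀ {k} → (Fin k → Bool) → ℕ
  countᵇ p = ∣ tabulate p ∣

  -- degree (a loop would count twice)
  degree : Fin n → ℕ
  degree v = countᵇ (λ e → ⌊ src G e ≟ v ⌋) + countᵇ (λ e → ⌊ tgt G e ≟ v ⌋)

  Trivalent : Set
  Trivalent = ∀ v → degree v ≡ 3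

  data Reach (F : Subset m) (u : Fin n) : Fin n → Set where
    here  : Reach F u u
    stepˢ : ∀ e → e ∈ F → Reach F u (src G e) → Reach F u (tgt G e)
    stepᵗ : ∀ e → e ∈ F → Reach F u (tgt G e) → Reach F u (src G e)

  ConnectedBy : Subset m → Set
  ConnectedBy F = ∀ u w → Reach F u w

  TwoEdgeConnected : Set
  TwoEdgeConnected = ConnectedBy ⊤ × (∀ e → ConnectedBy (⊤ - e))

  inducedEdges : Subset n → Subset m
  inducedEdges A = tabulate (λ e → lookup A (src G e) ∧ lookup A (tgt G e))

  -- G[A] is connected: any two vertices of A are joined by a walk in G[A]
  -- (a walk using only edges of G[A] starting in A stays inside A)
  InducedConnected : Subset n → Set
  InducedConnected A = ∀ u w → u ∈ A → w ∈ A → Reach (inducedEdges A) u w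

  AdjacentTo : Fin n → Subset n → Set
  AdjacentTo v A = ∃ λ e → ∃ λ a → a ∈ A ×
    ((src G e ≡ v × tgt G e ≡ a) ⊎ (src G e ≡ a × tgt G e ≡ v))

  δ : Subset n → Subset m
  δ A = tabulate (λ e → lookup A (src G e) ∨ lookup A (tgt G e))

  -- Number of connected components of the spanning subgraph (V,F).
  -- closure F u = set of vertices reachable from u in (V,F), computed by
  -- n rounds of neighbourhood expansion (walks of length ≤ n suffice).

  expand : Subset m → Subset n → Subset n
  expand F S = tabulate (λ w → lookup S w ∨ any (λ e → lookup F e ∧
      ((⌊ tgt G e ≟ w ⌋ ∧ lookup S (src G e)) ∨ (⌊ src G e ≟ w ⌋ ∧ lookup S (tgt G e))))
      (allFin m))

  iter : ℕ → (Subset n → Subset n) → Subset n → Subset n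
  iter zero    f S = S
  iter (suc k) f S = f (iter k f S)

  closure : Subset m → Fin n → Subset n
  closure F u = iter n (expand F) ⁅ u ⁆

  -- count the vertices that are the least vertex of their component
  components : Subset m → ℕ
  components F = countᵇ (λ v → not (any (λ w → ⌊ w <? v ⌋ ∧ lookup (closure F v) w) (allFin n)))

  cycleRank : Subset m → ℕ
  cycleRank F = n ∸ components F

  -- rank function of the bond matroid (dual of the cycle matroid):
  -- r*(X) = |X| + r(E - X) - r(E)
  bondRank : Subset m → ℕ
  bondRank X = ∣ X ∣ + cycleRank (⊤ ─ X) ∸ cycleRank ⊤

  subsets : ∀ k → List (Subset k)
  subsets zero    = [ [] ]
  subsets (suc k) = map (outside ∷_) (subsets k) ++ map (inside ∷_) (subsets k)

  dependentᵇ : Subset n → Bool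
  dependentᵇ A = bondRank (δ A) ≤ᵇ ∣ A ∣

  circuitᵇ : Subset n → Bool
  circuitᵇ C = ⌊ nonempty? C ⌋ ∧ dependentᵇ C ∧
    all (λ B → not (⌊ B ⊂? C ⌋ ∧ ⌊ nonempty? B ⌋ ∧ dependentᵇ B)) (subsets n)

  independentᵇ : Subset n → Bool
  independentᵇ I = all (λ C → not (⌊ C ⊆? I ⌋ ∧ circuitᵇ C)) (subsets n)

  rankM : Subset n → ℕ
  rankM A = foldr _⊔_ 0 (map (λ I → if ⌊ I ⊆? A ⌋ ∧ independentᵇ I then ∣ I ∣ else 0) (subsets n))

module Submission where

-- Write corank X = ∣X∣ + r(E − X) = r*(X) + r(E), X = δ(A) and X' = δ(A ∪ {v}).
-- A trivalent bridgeless graph has no loops, so v has exactly three edges: e₀ into A and two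
-- more, e₁ and e₂, with other ends x₁, x₂ ≠ v; hence X' = X ∪ {e₁, e₂}.  Adding one edge to a
-- set raises its corank by at most one, and not at all if the edge is a bridge of the
-- complement.  Once e₁ has been added, e₂ is the last edge at v, hence such a bridge; this
-- gives (a).  If the bond rank does jump, then e₁, e₂ ∉ X and x₁, x₂ are joined in E − X', so
-- corank(Y ∪ {e₁, e₂}) > corank Y for every Y ⊆ X.  Let C ⊆ A ∪ {v} with v ∈ C.  Either
-- B = C − v is nonempty and r*(δB) < r*(δC), so B is dependent when C is, or C = {v} and
-- r*(δC) ≥ 2 > ∣C∣.  Hence no circuit of M_G passes through v inside A ∪ {v}: v can be added
-- to every independent subset of A, and the rank grows.

open import Defs
open import Data.Bool using (Bool; true; false; _∧_; _∨_; not; T; if_then_else_)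
open import Data.Bool.ListAction using (any)
open import Data.Bool.Properties using (T-∧; T-∨; T-≡)
open import Data.Empty using (⊥; ⊥-elim)
open import Data.Fin as Fin using (Fin; zero; suc)
open import Data.Fin.Induction using (<-wellFounded)
open import Data.Fin.Properties as Fin using (_≟_; _<?_)
open import Data.Fin.Subset
  using (Subset; inside; outside; ⁅_⁆; ∣_∣; _∈_; _∉_; _─_; _-_; ⊤; _∪_; _∩_; _⊆_; _⊂_; Nonempty)
  renaming (⊥ to ∅)
open import Data.Fin.Subset.Properties
  using ( ∉⊥; ∈⊤; x∈⁅x⁆; x∈⁅y⁆⇒x≡y; x∉⁅y⁆⇒x≢y; _∈?_; _⊆?_; _⊂?_; nonempty?; Empty-unique
        ; drop-there; ⊆-min; ⊆-antisym; p⊆p∪q; q⊆p∪q; x∈p∪q⁺; x∈p∪q⁻; x∈p∩q⁺; x∈p∩q⁻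
        ; ∪-identityˡ; ∪-identityʳ; ∪-assoc; p─⊥≡p; p─q⊆p; x∈p∧x∉q⇒x∈p─q; x∈p∧x≢y⇒x∈p-y
        ; ∣⊥∣≡0; ∣⁅x⁆∣≡1; ∣p∣≤n; ∣p∣≤∣x∷p∣; p⊆q⇒∣p∣≤∣q∣; p⊂q⇒∣p∣<∣q∣ )
open import Data.List using (allFin; map)
open import Data.List.Membership.Propositional using () renaming (_∈_ to _∈ˡ_)
open import Data.List.Membership.Propositional.Properties using (∈-map⁺; ∈-++⁺ˡ; ∈-++⁺ʳ)
open import Data.List.Properties using (foldr-preservesᵇ; foldr-preservesᵒ)
import Data.List.Relation.Unary.All as All
open import Data.List.Relation.Unary.All.Properties as All using (all⁺; all⁻)
import Data.List.Relation.Unary.Any as Any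
open import Data.List.Relation.Unary.Any.Properties as Any using (any⁺; any⁻)
open import Data.Nat using (ℕ; zero; suc; pred; _+_; _∸_; _≤_; _<_; z≤n; s≤s)
open import Data.Nat.Properties
  using ( ≤-refl; ≤-reflexive; ≤-trans; <-≤-trans; ≤-<-trans; <⇒≱; n≤1+n; pred-mono-≤
        ; +-comm; +-suc; +-identityʳ; +-mono-≤; +-monoʳ-≤; suc-injective; 0≢1+n; m+1+n≢0; m+1+n≰m
        ; m∸n≤m; ∸-monoˡ-≤; ∸-monoʳ-≤; ∸-monoʳ-<; pred[m∸n]≡m∸[1+n]; m+n≤o⇒m≤o∸n
        ; ⊔-pres-<m; m≤n⇒m≤n⊔o; m≤n⇒m≤o⊔n; ≤ᵇ⇒≤; ≤⇒≤ᵇ; module ≤-Reasoning )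
open import Data.Product using (_×_; _,_; ∃; proj₁; proj₂)
open import Data.Sum as Sum using (_⊎_; inj₁; inj₂; [_,_]′)
open import Data.Vec using ([]; _∷_; here; there; tabulate; lookup)
open import Data.Vec.Properties using (lookup∘tabulate; []=⇒lookup; lookup⇒[]=)
open import Function using (_∘_; _⇔_; Equivalence; mk⇔; case_of_)
open import Induction.WellFounded using (Acc; acc)
open import Relation.Binary using (_⇒_; tri<; tri≈; tri>)
open import Relation.Binary.PropositionalEquality
  using (_≡_; _≢_; refl; sym; trans; cong; cong₂; subst; module ≡-Reasoning)
open import Relation.Nullary using (¬_; yes; no; Dec)
open import Relation.Nullary.Decidable using (⌊_⌋; T?; fromWitness; toWitness; map′; decidable-stable)

private
  variable
    k : ℕ

module T-∧ {x y} = Equivalence (T-∧ {x} {y})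
module T-∨ {x y} = Equivalence (T-∨ {x} {y})

T-not⇔¬T : ∀ {b} → T (not b) ⇔ (¬ T b)
T-not⇔¬T {true}  = mk⇔ (λ ()) (λ ¬t → ¬t _)
T-not⇔¬T {false} = mk⇔ (λ _ ()) (λ _ → _)

∸-suc-≤ : ∀ m k → suc m ∸ k ≤ suc (m ∸ k)
∸-suc-≤ m       zero    = ≤-refl
∸-suc-≤ zero    (suc k) = ≤-trans (m∸n≤m 0 k) z≤n
∸-suc-≤ (suc m) (suc k) = ∸-suc-≤ m k

<⇒∸≤pred∸ : ∀ {m n} k → m < n → m ∸ k ≤ pred (n ∸ k)
<⇒∸≤pred∸ {n = n} k m<n = ≤-trans (∸-monoˡ-≤ (suc k) m<n) (≤-reflexive (sym (pred[m∸n]≡m∸[1+n] n k)))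

m+1+n≡1⇒m≡0 : ∀ m {n} → m + suc n ≡ 1 → m ≡ 0
m+1+n≡1⇒m≡0 zero    _  = refl
m+1+n≡1⇒m≡0 (suc m) eq = ⊥-elim (m+1+n≢0 m (suc-injective eq))

∈⇒T-lookup : ∀ {x : Fin k} {p} → x ∈ p → T (lookup p x)
∈⇒T-lookup x∈p = Equivalence.from T-≡ ([]=⇒lookup x∈p)

T-lookup⇒∈ : ∀ {x : Fin k} {p} → T (lookup p x) → x ∈ p
T-lookup⇒∈ {x = x} {p} t = lookup⇒[]= x p (Equivalence.to T-≡ t)

∈-tabulate⁺ : ∀ {f : Fin k → Bool} {x} → T (f x) → x ∈ tabulate f
∈-tabulate⁺ {f = f} {x} t = T-lookup⇒∈ (subst T (sym (lookup∘tabulate f x)) t)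

∈-tabulate⁻ : ∀ {f : Fin k → Bool} {x} → x ∈ tabulate f → T (f x)
∈-tabulate⁻ {f = f} {x} x∈ = subst T (lookup∘tabulate f x) (∈⇒T-lookup x∈)

x∈p─q⇒x∉q : ∀ {x : Fin k} p q → x ∈ p ─ q → x ∉ q
x∈p─q⇒x∉q (_ ∷ p) (outside ∷ q) here       ()
x∈p─q⇒x∉q (_ ∷ p) (_ ∷ q)       (there x∈) (there x∈q) = x∈p─q⇒x∉q p q x∈ x∈q

x∈p-y⁻ : ∀ {x : Fin k} p y → x ∈ p - y → x ∈ p × x ≢ y
x∈p-y⁻ p y x∈ = p─q⊆p p ⁅ y ⁆ x∈ , x∉⁅y⁆⇒x≢y (x∈p─q⇒x∉q p ⁅ y ⁆ x∈)

∈⊤─⁺ : ∀ {x : Fin k} {p} → x ∉ p → x ∈ ⊤ ─ p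
∈⊤─⁺ = x∈p∧x∉q⇒x∈p─q ∈⊤

∈⊤─⁻ : ∀ {x : Fin k} {p} → x ∈ ⊤ ─ p → x ∉ p
∈⊤─⁻ = x∈p─q⇒x∉q ⊤ _

⊤─-antitone : ∀ {p q : Subset k} → p ⊆ q → ⊤ ─ q ⊆ ⊤ ─ p
⊤─-antitone p⊆q x∈ = ∈⊤─⁺ (∈⊤─⁻ x∈ ∘ p⊆q)

⊤─p⊆⊤─[p∪⁅x⁆]∪⁅x⁆ : ∀ (p : Subset k) {x} → ⊤ ─ p ⊆ (⊤ ─ (p ∪ ⁅ x ⁆)) ∪ ⁅ x ⁆
⊤─p⊆⊤─[p∪⁅x⁆]∪⁅x⁆ p {x} {y} y∈ with y ≟ x
... | yes refl = q⊆p∪q _ _ (x∈⁅x⁆ x)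
... | no y≢x   = p⊆p∪q _ (∈⊤─⁺ ([ ∈⊤─⁻ y∈ , y≢x ∘ x∈⁅y⁆⇒x≡y x ]′ ∘ x∈p∪q⁻ p ⁅ x ⁆))

∪-monoˡ : ∀ {p q r : Subset k} → p ⊆ q → p ∪ r ⊆ q ∪ r
∪-monoˡ {r = r} p⊆q = [ p⊆p∪q r ∘ p⊆q , q⊆p∪q _ r ]′ ∘ x∈p∪q⁻ _ r

x∈p⇒⁅x⁆⊆p : ∀ {x : Fin k} {p} → x ∈ p → ⁅ x ⁆ ⊆ p
x∈p⇒⁅x⁆⊆p {x = x} {p} x∈p y∈⁅x⁆ = subst (_∈ p) (sym (x∈⁅y⁆⇒x≡y x y∈⁅x⁆)) x∈p

p∪⁅x⁆≡p : ∀ {x : Fin k} {p} → x ∈ p → p ∪ ⁅ x ⁆ ≡ p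
p∪⁅x⁆≡p {x = x} {p} x∈p = ⊆-antisym ([ (λ y∈p → y∈p) , x∈p⇒⁅x⁆⊆p x∈p ]′ ∘ x∈p∪q⁻ p ⁅ x ⁆) (p⊆p∪q ⁅ x ⁆)

p≡p-x∪⁅x⁆ : ∀ {x : Fin k} {p} → x ∈ p → p ≡ (p - x) ∪ ⁅ x ⁆
p≡p-x∪⁅x⁆ {x = x} {p} x∈p = ⊆-antisym split (join ∘ x∈p∪q⁻ (p - x) ⁅ x ⁆)
  where
  split : p ⊆ (p - x) ∪ ⁅ x ⁆
  split {y} y∈p with y ≟ x
  ... | yes refl = q⊆p∪q _ _ (x∈⁅x⁆ x)
  ... | no y≢x   = p⊆p∪q _ (x∈p∧x≢y⇒x∈p-y y∈p y≢x)

  join : ∀ {y} → y ∈ p - x ⊎ y ∈ ⁅ x ⁆ → y ∈ p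
  join = [ p─q⊆p p ⁅ x ⁆ , x∈p⇒⁅x⁆⊆p x∈p ]′

∣p∪q∣+∣p∩q∣≡∣p∣+∣q∣ : ∀ (p q : Subset k) → ∣ p ∪ q ∣ + ∣ p ∩ q ∣ ≡ ∣ p ∣ + ∣ q ∣
∣p∪q∣+∣p∩q∣≡∣p∣+∣q∣ []            []            = refl
∣p∪q∣+∣p∩q∣≡∣p∣+∣q∣ (inside  ∷ p) (inside  ∷ q) =
  cong suc (trans (+-suc _ _) (trans (cong suc (∣p∪q∣+∣p∩q∣≡∣p∣+∣q∣ p q)) (sym (+-suc _ _))))
∣p∪q∣+∣p∩q∣≡∣p∣+∣q∣ (inside  ∷ p) (outside ∷ q) = cong suc (∣p∪q∣+∣p∩q∣≡∣p∣+∣q∣ p q)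
∣p∪q∣+∣p∩q∣≡∣p∣+∣q∣ (outside ∷ p) (inside  ∷ q) =
  trans (cong suc (∣p∪q∣+∣p∩q∣≡∣p∣+∣q∣ p q)) (sym (+-suc _ _))
∣p∪q∣+∣p∩q∣≡∣p∣+∣q∣ (outside ∷ p) (outside ∷ q) = ∣p∪q∣+∣p∩q∣≡∣p∣+∣q∣ p q

∣p∣≡1+∣p-x∣ : ∀ {x : Fin k} {p} → x ∈ p → ∣ p ∣ ≡ suc ∣ p - x ∣
∣p∣≡1+∣p-x∣ {p = inside  ∷ p} here        = cong (suc ∘ ∣_∣) (sym (p─⊥≡p p))
∣p∣≡1+∣p-x∣ {p = inside  ∷ p} (there x∈p) = cong suc (∣p∣≡1+∣p-x∣ x∈p)
∣p∣≡1+∣p-x∣ {p = outside ∷ p} (there x∈p) = ∣p∣≡1+∣p-x∣ x∈p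

∣p∣≡0⇒x∉p : ∀ {x : Fin k} {p} → ∣ p ∣ ≡ 0 → x ∉ p
∣p∣≡0⇒x∉p ∣p∣≡0 x∈p = 0≢1+n (trans (sym ∣p∣≡0) (∣p∣≡1+∣p-x∣ x∈p))

∣p∣≡1+j⇒∃x∈p : ∀ {k} {p : Subset k} {j} → ∣ p ∣ ≡ suc j → ∃ λ x → x ∈ p × ∣ p - x ∣ ≡ j
∣p∣≡1+j⇒∃x∈p {k} {p} ∣p∣≡1+j with nonempty? p
... | yes (x , x∈p) = x , x∈p , suc-injective (trans (sym (∣p∣≡1+∣p-x∣ x∈p)) ∣p∣≡1+j)
... | no p-empty    = ⊥-elim (0≢1+n (trans (sym (trans (cong ∣_∣ (Empty-unique p-empty)) (∣⊥∣≡0 k))) ∣p∣≡1+j))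

∣p∪⁅x⁆∣≡1+∣p∣ : ∀ {x : Fin k} {p} → x ∉ p → ∣ p ∪ ⁅ x ⁆ ∣ ≡ suc ∣ p ∣
∣p∪⁅x⁆∣≡1+∣p∣ {x = zero}  {inside  ∷ p} x∉p = ⊥-elim (x∉p here)
∣p∪⁅x⁆∣≡1+∣p∣ {x = zero}  {outside ∷ p} x∉p = cong (suc ∘ ∣_∣) (∪-identityʳ p)
∣p∪⁅x⁆∣≡1+∣p∣ {x = suc x} {inside  ∷ p} x∉p = cong suc (∣p∪⁅x⁆∣≡1+∣p∣ (x∉p ∘ there))
∣p∪⁅x⁆∣≡1+∣p∣ {x = suc x} {outside ∷ p} x∉p = ∣p∪⁅x⁆∣≡1+∣p∣ (x∉p ∘ there)

∣p∪⁅x⁆∣≤1+∣p∣ : ∀ (p : Subset k) {x} → ∣ p ∪ ⁅ x ⁆ ∣ ≤ suc ∣ p ∣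
∣p∪⁅x⁆∣≤1+∣p∣ p {x} with x ∈? p
... | yes x∈p = ≤-trans (≤-reflexive (cong ∣_∣ (p∪⁅x⁆≡p x∈p))) (n≤1+n _)
... | no x∉p  = ≤-reflexive (∣p∪⁅x⁆∣≡1+∣p∣ x∉p)

AtMostOneOutside : Subset k → Subset k → Set
AtMostOneOutside p q = ∀ {x y} → x ∈ q → x ∉ p → y ∈ q → y ∉ p → x ≡ y

AtMostOneOutside-tail : ∀ {s t} {p q : Subset k} → AtMostOneOutside (s ∷ p) (t ∷ q) → AtMostOneOutside p q
AtMostOneOutside-tail at-most-one x∈ x∉ y∈ y∉ =
  Fin.suc-injective (at-most-one (there x∈) (x∉ ∘ drop-there) (there y∈) (y∉ ∘ drop-there))

∣q∣≤1+∣p∣ : ∀ {p q : Subset k} → AtMostOneOutside p q → ∣ q ∣ ≤ suc ∣ p ∣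
∣q∣≤1+∣p∣ {p = []}          {[]}          _           = z≤n
∣q∣≤1+∣p∣ {p = outside ∷ p} {inside  ∷ q} at-most-one = s≤s (p⊆q⇒∣p∣≤∣q∣ q⊆p)
  where
  q⊆p : q ⊆ p
  q⊆p {x} x∈q with x ∈? p
  ... | yes x∈p = x∈p
  ... | no x∉p  = ⊥-elim (Fin.0≢1+n (at-most-one here (λ ()) (there x∈q) (x∉p ∘ drop-there)))
∣q∣≤1+∣p∣ {p = inside  ∷ p} {inside  ∷ q} at-most-one = s≤s (∣q∣≤1+∣p∣ (AtMostOneOutside-tail at-most-one))
∣q∣≤1+∣p∣ {p = s       ∷ p} {outside ∷ q} at-most-one =
  ≤-trans (∣q∣≤1+∣p∣ (AtMostOneOutside-tail at-most-one)) (s≤s (∣p∣≤∣x∷p∣ s p))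

-- Walks

module _ {n m : ℕ} (G : Graph n m) where

  Joins : Fin m → Fin n → Fin n → Set
  Joins e u w = (src G e ≡ u × tgt G e ≡ w) ⊎ (src G e ≡ w × tgt G e ≡ u)

  Incident : Fin m → Fin n → Set
  Incident e v = src G e ≡ v ⊎ tgt G e ≡ v

  Isolated : Subset m → Fin n → Set
  Isolated F v = ∀ {w} → Reach G F v w → w ≡ v

  module _ {F : Subset m} where

    Reach-trans : ∀ {u w z} → Reach G F u w → Reach G F w z → Reach G F u z
    Reach-trans p here            = p
    Reach-trans p (stepˢ e e∈F q) = stepˢ e e∈F (Reach-trans p q)
    Reach-trans p (stepᵗ e e∈F q) = stepᵗ e e∈F (Reach-trans p q)

    Reach-along : ∀ {e u w} → e ∈ F → Joins e u w → Reach G F u w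
    Reach-along {e} e∈F (inj₁ (refl , refl)) = stepˢ e e∈F here
    Reach-along {e} e∈F (inj₂ (refl , refl)) = stepᵗ e e∈F here

    Reach-sym : ∀ {u w} → Reach G F u w → Reach G F w u
    Reach-sym here            = here
    Reach-sym (stepˢ e e∈F p) = Reach-trans (Reach-along e∈F (inj₂ (refl , refl))) (Reach-sym p)
    Reach-sym (stepᵗ e e∈F p) = Reach-trans (Reach-along e∈F (inj₁ (refl , refl))) (Reach-sym p)

    Reach-endpoints : ∀ {e u w} → Joins e u w → Reach G F u w → Reach G F (src G e) (tgt G e)
    Reach-endpoints (inj₁ (refl , refl)) p = p
    Reach-endpoints (inj₂ (refl , refl)) p = Reach-sym p

    loops-only⇒isolated : ∀ {v} → (∀ {e} → e ∈ F → Incident e v → src G e ≡ tgt G e) → Isolated F v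
    loops-only⇒isolated loops here = refl
    loops-only⇒isolated {v} loops (stepˢ e e∈F p) = trans (sym (loops e∈F (inj₁ src≡v))) src≡v
      where
      src≡v : src G e ≡ v
      src≡v = loops-only⇒isolated loops p
    loops-only⇒isolated {v} loops (stepᵗ e e∈F p) = trans (loops e∈F (inj₂ tgt≡v)) tgt≡v
      where
      tgt≡v : tgt G e ≡ v
      tgt≡v = loops-only⇒isolated loops p

  Reach-mono : ∀ {F F' u w} → F ⊆ F' → Reach G F u w → Reach G F' u w
  Reach-mono F⊆F' here            = here
  Reach-mono F⊆F' (stepˢ e e∈F p) = stepˢ e (F⊆F' e∈F) (Reach-mono F⊆F' p)
  Reach-mono F⊆F' (stepᵗ e e∈F p) = stepᵗ e (F⊆F' e∈F) (Reach-mono F⊆F' p)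

  ReachVia : Subset m → Fin m → Fin n → Fin n → Set
  ReachVia F e u w = Reach G F u w
                   ⊎ (Reach G F u (src G e) × Reach G F (tgt G e) w)
                   ⊎ (Reach G F u (tgt G e) × Reach G F (src G e) w)

  module _ {F : Subset m} {e : Fin m} where

    ReachVia-++ : ∀ {u w z} → ReachVia F e u w → Reach G F w z → ReachVia F e u z
    ReachVia-++ (inj₁ p)             q = inj₁ (Reach-trans p q)
    ReachVia-++ (inj₂ (inj₁ (p , r))) q = inj₂ (inj₁ (p , Reach-trans r q))
    ReachVia-++ (inj₂ (inj₂ (p , r))) q = inj₂ (inj₂ (p , Reach-trans r q))

    ReachVia-crossˢ : ∀ {u} → ReachVia F e u (src G e) → ReachVia F e u (tgt G e)
    ReachVia-crossˢ (inj₁ p)             = inj₂ (inj₁ (p , here))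
    ReachVia-crossˢ (inj₂ (inj₁ (p , _))) = inj₂ (inj₁ (p , here))
    ReachVia-crossˢ (inj₂ (inj₂ (p , _))) = inj₁ p

    ReachVia-crossᵗ : ∀ {u} → ReachVia F e u (tgt G e) → ReachVia F e u (src G e)
    ReachVia-crossᵗ (inj₁ p)             = inj₂ (inj₂ (p , here))
    ReachVia-crossᵗ (inj₂ (inj₁ (p , _))) = inj₁ p
    ReachVia-crossᵗ (inj₂ (inj₂ (p , _))) = inj₂ (inj₂ (p , here))

    Reach-split : ∀ {F' u w} → F' ⊆ F ∪ ⁅ e ⁆ → Reach G F' u w → ReachVia F e u w
    Reach-split F'⊆ here = inj₁ here
    Reach-split F'⊆ (stepˢ e' e'∈F' p) with x∈p∪q⁻ _ _ (F'⊆ e'∈F')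
    ... | inj₁ e'∈F = ReachVia-++ (Reach-split F'⊆ p) (stepˢ e' e'∈F here)
    ... | inj₂ e'∈⁅e⁆ with x∈⁅y⁆⇒x≡y e e'∈⁅e⁆
    ...   | refl = ReachVia-crossˢ (Reach-split F'⊆ p)
    Reach-split F'⊆ (stepᵗ e' e'∈F' p) with x∈p∪q⁻ _ _ (F'⊆ e'∈F')
    ... | inj₁ e'∈F = ReachVia-++ (Reach-split F'⊆ p) (stepᵗ e' e'∈F here)
    ... | inj₂ e'∈⁅e⁆ with x∈⁅y⁆⇒x≡y e e'∈⁅e⁆
    ...   | refl = ReachVia-crossᵗ (Reach-split F'⊆ p)

    Reach-bypass : ∀ {F' u w} → F' ⊆ F ∪ ⁅ e ⁆ → Reach G F (src G e) (tgt G e) →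
                   Reach G F' u w → Reach G F u w
    Reach-bypass F'⊆ st p with Reach-split F'⊆ p
    ... | inj₁ q             = q
    ... | inj₂ (inj₁ (q , r)) = Reach-trans q (Reach-trans st r)
    ... | inj₂ (inj₂ (q , r)) = Reach-trans q (Reach-trans (Reach-sym st) r)

    Reach-pendant : ∀ {F' v x w} → F' ⊆ F ∪ ⁅ e ⁆ → Isolated F v → Joins e v x →
                    Reach G F' v w → w ≡ v ⊎ Reach G F x w
    Reach-pendant F'⊆ iso joins p with Reach-split F'⊆ p | joins
    ... | inj₁ q             | _               = inj₁ (iso q)
    ... | inj₂ (inj₁ (_ , r)) | inj₁ (_ , refl) = inj₂ r
    ... | inj₂ (inj₁ (_ , r)) | inj₂ (_ , refl) = inj₁ (iso r)
    ... | inj₂ (inj₂ (_ , r)) | inj₁ (refl , _) = inj₁ (iso r)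
    ... | inj₂ (inj₂ (_ , r)) | inj₂ (refl , _) = inj₂ r

  -- Closures, and decidability of reachability

  -- The test in expand G F S that the edge e leads from S to w.
  crossesInto : Subset n → Fin n → Fin m → Bool
  crossesInto S w e = (⌊ tgt G e ≟ w ⌋ ∧ lookup S (src G e)) ∨ (⌊ src G e ≟ w ⌋ ∧ lookup S (tgt G e))

  crossesInto⁺ : ∀ {S e u w} → u ∈ S → Joins e u w → T (crossesInto S w e)
  crossesInto⁺ {e = e} u∈S (inj₁ (refl , refl)) =
    T-∨.from (inj₁ (T-∧.from (fromWitness {a? = tgt G e ≟ _} refl , ∈⇒T-lookup u∈S)))
  crossesInto⁺ {e = e} u∈S (inj₂ (refl , refl)) =
    T-∨.from (inj₂ (T-∧.from (fromWitness {a? = src G e ≟ _} refl , ∈⇒T-lookup u∈S)))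

  crossesInto⁻ : ∀ {S e w} → T (crossesInto S w e) → ∃ λ u → u ∈ S × Joins e u w
  crossesInto⁻ {S} {e} {w} t with T-∨.to {x = ⌊ tgt G e ≟ w ⌋ ∧ lookup S (src G e)} t
  ... | inj₁ t' = let tgt≡w , src∈S = T-∧.to {x = ⌊ tgt G e ≟ w ⌋} t' in
                  src G e , T-lookup⇒∈ src∈S , inj₁ (refl , toWitness tgt≡w)
  ... | inj₂ t' = let src≡w , tgt∈S = T-∧.to {x = ⌊ src G e ≟ w ⌋} t' in
                  tgt G e , T-lookup⇒∈ tgt∈S , inj₂ (toWitness src≡w , refl)

  module _ {F : Subset m} where

    ∈-expand⁺ : ∀ {S e u w} → e ∈ F → u ∈ S → Joins e u w → w ∈ expand G F S
    ∈-expand⁺ {e = e} e∈F u∈S joins =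
      ∈-tabulate⁺ (T-∨.from (inj₂ (any⁺ _ (Any.tabulate⁺ e
        (T-∧.from (∈⇒T-lookup e∈F , crossesInto⁺ u∈S joins))))))

    ∈-expand⁻ : ∀ {S w} → w ∈ expand G F S → w ∈ S ⊎ ∃ λ e → e ∈ F × ∃ λ u → u ∈ S × Joins e u w
    ∈-expand⁻ {S} {w} w∈ with T-∨.to {x = lookup S w} (∈-tabulate⁻ w∈)
    ... | inj₁ w∈S      = inj₁ (T-lookup⇒∈ w∈S)
    ... | inj₂ crossing with Any.satisfied (any⁻ (λ e → lookup F e ∧ crossesInto S w e) (allFin m) crossing)
    ...   | e , t = let e∈F , crosses = T-∧.to {x = lookup F e} t in
                    inj₂ (e , T-lookup⇒∈ e∈F , crossesInto⁻ crosses)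

    expand-inflationary : ∀ {S} → S ⊆ expand G F S
    expand-inflationary w∈S = ∈-tabulate⁺ (T-∨.from (inj₁ (∈⇒T-lookup w∈S)))

    Closed : Subset n → Set
    Closed S = expand G F S ⊆ S

    closed-under-Reach : ∀ {S u w} → Closed S → u ∈ S → Reach G F u w → w ∈ S
    closed-under-Reach closed u∈S here = u∈S
    closed-under-Reach closed u∈S (stepˢ e e∈F p) =
      closed (∈-expand⁺ e∈F (closed-under-Reach closed u∈S p) (inj₁ (refl , refl)))
    closed-under-Reach closed u∈S (stepᵗ e e∈F p) =
      closed (∈-expand⁺ e∈F (closed-under-Reach closed u∈S p) (inj₂ (refl , refl)))

    expand-closed : ∀ {S} → Closed S → Closed (expand G F S)
    expand-closed {S} closed = subst Closed (sym (⊆-antisym closed expand-inflationary)) closed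

    grows-or-closed : ∀ S → S ⊂ expand G F S ⊎ Closed S
    grows-or-closed S with S ⊂? expand G F S
    ... | yes S⊂ = inj₁ S⊂
    ... | no S⊄ = inj₂ closed
      where
      closed : Closed S
      closed {x} x∈ with x ∈? S
      ... | yes x∈S = x∈S
      ... | no x∉S = ⊥-elim (S⊄ (expand-inflationary , x , x∈ , x∉S))

    module _ (u : Fin n) where

      stage : ℕ → Subset n
      stage j = iter G j (expand G F) ⁅ u ⁆

      stage-∋ : ∀ j → u ∈ stage j
      stage-∋ zero    = x∈⁅x⁆ u
      stage-∋ (suc j) = expand-inflationary (stage-∋ j)

      stage-sound : ∀ j {w} → w ∈ stage j → Reach G F u w
      stage-sound zero w∈ = subst (Reach G F u) (sym (x∈⁅y⁆⇒x≡y u w∈)) here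
      stage-sound (suc j) w∈ with ∈-expand⁻ w∈
      ... | inj₁ w∈S = stage-sound j w∈S
      ... | inj₂ (_ , e∈F , _ , v∈S , joins) = Reach-trans (stage-sound j v∈S) (Reach-along e∈F joins)

      stage-grows-or-closed : ∀ j → suc j ≤ ∣ stage j ∣ ⊎ Closed (stage j)
      stage-grows-or-closed zero = inj₁ (≤-reflexive (sym (∣⁅x⁆∣≡1 u)))
      stage-grows-or-closed (suc j) with stage-grows-or-closed j
      ... | inj₂ closed = inj₂ (expand-closed closed)
      ... | inj₁ large with grows-or-closed (stage j)
      ...   | inj₁ grows  = inj₁ (≤-trans (s≤s large) (p⊂q⇒∣p∣<∣q∣ grows))
      ...   | inj₂ closed = inj₂ (expand-closed closed)

      closure-closed : Closed (closure G F u)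
      closure-closed with stage-grows-or-closed n
      ... | inj₁ large  = ⊥-elim (<⇒≱ large (∣p∣≤n (closure G F u)))
      ... | inj₂ closed = closed

    ∈-closure⁻ : ∀ {u w} → w ∈ closure G F u → Reach G F u w
    ∈-closure⁻ {u} = stage-sound u n

    ∈-closure⁺ : ∀ {u w} → Reach G F u w → w ∈ closure G F u
    ∈-closure⁺ {u} = closed-under-Reach (closure-closed u) (stage-∋ u n)

  Reach? : ∀ F u w → Dec (Reach G F u w)
  Reach? F u w = map′ ∈-closure⁻ ∈-closure⁺ (w ∈? closure G F u)

  -- Connected components

  -- components G F ≡ ∣ roots F ∣ holds by definition.
  roots : Subset m → Subset n
  roots F = tabulate (λ v → not (any (λ w → ⌊ w <? v ⌋ ∧ lookup (closure G F v) w) (allFin n)))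

  IsRoot : Subset m → Fin n → Set
  IsRoot F v = ∀ {w} → w Fin.< v → ¬ Reach G F v w

  module _ {F : Subset m} {v : Fin n} where

    private
      reachesSmaller : Bool
      reachesSmaller = any (λ w → ⌊ w <? v ⌋ ∧ lookup (closure G F v) w) (allFin n)

      reachesSmaller⁺ : ∀ {w} → w Fin.< v → Reach G F v w → T reachesSmaller
      reachesSmaller⁺ {w} w<v p =
        any⁺ _ (Any.tabulate⁺ w (T-∧.from (fromWitness w<v , ∈⇒T-lookup (∈-closure⁺ p))))

      reachesSmaller⁻ : T reachesSmaller → ∃ λ w → w Fin.< v × Reach G F v w
      reachesSmaller⁻ t with Any.satisfied (any⁻ _ (allFin n) t)
      ... | w , t' = let w<v , w∈ = T-∧.to {x = ⌊ w <? v ⌋} t' in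
                     w , toWitness w<v , ∈-closure⁻ (T-lookup⇒∈ w∈)

    ∈-roots⁺ : IsRoot F v → v ∈ roots F
    ∈-roots⁺ root = ∈-tabulate⁺ (Equivalence.from T-not⇔¬T λ t →
      let _ , w<v , p = reachesSmaller⁻ t in root w<v p)

    ∈-roots⁻ : v ∈ roots F → IsRoot F v
    ∈-roots⁻ v∈ w<v p = Equivalence.to T-not⇔¬T (∈-tabulate⁻ v∈) (reachesSmaller⁺ w<v p)

    ∉-roots⁻ : v ∉ roots F → ∃ λ w → w Fin.< v × Reach G F v w
    ∉-roots⁻ v∉ = reachesSmaller⁻ (decidable-stable (T? reachesSmaller)
      λ ¬t → v∉ (∈-tabulate⁺ (Equivalence.from T-not⇔¬T ¬t)))

  module _ {F : Subset m} where

    rootOf : ∀ u → ∃ λ r → IsRoot F r × Reach G F u r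
    rootOf u = go u (<-wellFounded u)
      where
      go : ∀ u → Acc Fin._<_ u → ∃ λ r → IsRoot F r × Reach G F u r
      go u (acc below) with u ∈? roots F
      ... | yes u∈ = u , ∈-roots⁻ u∈ , here
      ... | no u∉ with ∉-roots⁻ u∉
      ...   | w , w<u , u~w with go w (below w<u)
      ...     | r , root , w~r = r , root , Reach-trans u~w w~r

    roots-unique : ∀ {p q} → IsRoot F p → IsRoot F q → Reach G F p q → p ≡ q
    roots-unique {p} {q} root-p root-q p~q with Fin.<-cmp p q
    ... | tri< p<q _ _ = ⊥-elim (root-q p<q (Reach-sym p~q))
    ... | tri≈ _ p≡q _ = p≡q
    ... | tri> _ _ q<p = ⊥-elim (root-p q<p p~q)

  module _ {F F' : Subset m} where

    roots-antitone : Reach G F' ⇒ Reach G F → roots F ⊆ roots F'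
    roots-antitone F'⇒F v∈ = ∈-roots⁺ (λ w<v p → ∈-roots⁻ v∈ w<v (F'⇒F p))

    components-antitone : Reach G F' ⇒ Reach G F → components G F ≤ components G F'
    components-antitone F'⇒F = p⊆q⇒∣p∣≤∣q∣ (roots-antitone F'⇒F)

    components-split : ∀ {u w} → Reach G F' ⇒ Reach G F → Reach G F u w → ¬ Reach G F' u w →
                       components G F < components G F'
    components-split {u} {w} F'⇒F u~w u≁w with rootOf u | rootOf w
    ... | p , root-p , u~p | q , root-q , w~q = p⊂q⇒∣p∣<∣q∣ (roots-antitone F'⇒F , new-root)
      where
      p≢q : p ≢ q
      p≢q refl = u≁w (Reach-trans u~p (Reach-sym w~q))

      p~q : Reach G F p q
      p~q = Reach-trans (Reach-sym (F'⇒F u~p)) (Reach-trans u~w (F'⇒F w~q))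

      new-root : ∃ λ x → x ∈ roots F' × x ∉ roots F
      new-root with p ∈? roots F
      ... | no p∉  = p , ∈-roots⁺ root-p , p∉
      ... | yes p∈ = q , ∈-roots⁺ root-q , λ q∈ → p≢q (roots-unique (∈-roots⁻ p∈) (∈-roots⁻ q∈) p~q)

    -- A root of F that is no root of F' reaches one end of e, and the other end reaches a smaller
    -- vertex; of two such roots, the larger one would then reach a vertex below it.
    components-link : ∀ {e} → Reach G F' ⇒ ReachVia F e → components G F ≤ suc (components G F')
    components-link {e} split = ∣q∣≤1+∣p∣ unique
      where
      Escapes : Fin n → Set
      Escapes x = (Reach G F x (src G e) × ∃ λ w → w Fin.< x × Reach G F (tgt G e) w)
                ⊎ (Reach G F x (tgt G e) × ∃ λ w → w Fin.< x × Reach G F (src G e) w)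

      escapes : ∀ {x} → x ∈ roots F → x ∉ roots F' → Escapes x
      escapes x∈ x∉ with ∉-roots⁻ x∉
      ... | w , w<x , x~w with split x~w
      ...   | inj₁ p             = ⊥-elim (∈-roots⁻ x∈ w<x p)
      ...   | inj₂ (inj₁ (p , q)) = inj₁ (p , w , w<x , q)
      ...   | inj₂ (inj₂ (p , q)) = inj₂ (p , w , w<x , q)

      no-two : ∀ {x y} → x Fin.< y → Escapes x → y ∈ roots F → Escapes y → ⊥
      no-two x<y (inj₁ (x~s , _)) y∈ (inj₁ (y~s , _)) = ∈-roots⁻ y∈ x<y (Reach-trans y~s (Reach-sym x~s))
      no-two x<y (inj₁ (_ , w , w<x , t~w)) y∈ (inj₂ (y~t , _)) =
        ∈-roots⁻ y∈ (Fin.<-trans w<x x<y) (Reach-trans y~t t~w)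
      no-two x<y (inj₂ (_ , w , w<x , s~w)) y∈ (inj₁ (y~s , _)) =
        ∈-roots⁻ y∈ (Fin.<-trans w<x x<y) (Reach-trans y~s s~w)
      no-two x<y (inj₂ (x~t , _)) y∈ (inj₂ (y~t , _)) = ∈-roots⁻ y∈ x<y (Reach-trans y~t (Reach-sym x~t))

      unique : AtMostOneOutside (roots F') (roots F)
      unique {x} {y} x∈ x∉ y∈ y∉ with Fin.<-cmp x y
      ... | tri< x<y _ _ = ⊥-elim (no-two x<y (escapes x∈ x∉) y∈ (escapes y∈ y∉))
      ... | tri≈ _ x≡y _ = x≡y
      ... | tri> _ _ y<x = ⊥-elim (no-two y<x (escapes y∈ y∉) x∈ (escapes x∈ x∉))

  -- Adding one edge to an edge set

  -- corank X = r*(X) + r(E), and bondRank G X is corank X ∸ cycleRank G ⊤ by definition.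
  corank : Subset m → ℕ
  corank Y = ∣ Y ∣ + cycleRank G (⊤ ─ Y)

  corank-∅ : corank ∅ ≡ cycleRank G ⊤
  corank-∅ = cong₂ _+_ (∣⊥∣≡0 m) (cong (cycleRank G) (p─⊥≡p ⊤))

  module _ {Y : Subset m} {e : Fin m} where

    private
      c c' : ℕ
      c  = components G (⊤ ─ Y)
      c' = components G (⊤ ─ (Y ∪ ⁅ e ⁆))

      c≤c' : c ≤ c'
      c≤c' = components-antitone {⊤ ─ Y} (Reach-mono (⊤─-antitone (p⊆p∪q ⁅ e ⁆)))

      c'≤1+c : c' ≤ suc c
      c'≤1+c = components-link {⊤ ─ (Y ∪ ⁅ e ⁆)} (Reach-split (⊤─p⊆⊤─[p∪⁅x⁆]∪⁅x⁆ Y))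

    corank-∪⁅⁆≤1+ : corank (Y ∪ ⁅ e ⁆) ≤ suc (corank Y)
    corank-∪⁅⁆≤1+ = +-mono-≤ (∣p∪⁅x⁆∣≤1+∣p∣ Y) (∸-monoʳ-≤ n c≤c')

    corank-mono-∪⁅⁆ : corank Y ≤ corank (Y ∪ ⁅ e ⁆)
    corank-mono-∪⁅⁆ with e ∈? Y
    ... | yes e∈Y = ≤-reflexive (cong corank (sym (p∪⁅x⁆≡p e∈Y)))
    ... | no e∉Y = begin
      ∣ Y ∣ + (n ∸ c)            ≤⟨ +-monoʳ-≤ ∣ Y ∣ n∸c≤1+n∸c' ⟩
      ∣ Y ∣ + suc (n ∸ c')       ≡⟨ +-suc ∣ Y ∣ _ ⟩
      suc ∣ Y ∣ + (n ∸ c')       ≡⟨ cong (_+ (n ∸ c')) (∣p∪⁅x⁆∣≡1+∣p∣ e∉Y) ⟨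
      corank (Y ∪ ⁅ e ⁆)         ∎
      where
      open ≤-Reasoning
      n∸c≤1+n∸c' : n ∸ c ≤ suc (n ∸ c')
      n∸c≤1+n∸c' = ≤-trans (∸-suc-≤ n (suc c)) (s≤s (∸-monoʳ-≤ n c'≤1+c))

    bridge⇒corank-∪⁅⁆≤ : ∀ {u w} → Joins e u w → ¬ Reach G (⊤ ─ (Y ∪ ⁅ e ⁆)) u w →
                         corank (Y ∪ ⁅ e ⁆) ≤ corank Y
    bridge⇒corank-∪⁅⁆≤ joins u≁w with e ∈? Y
    ... | yes e∈Y = ≤-reflexive (cong corank (p∪⁅x⁆≡p e∈Y))
    ... | no e∉Y = begin
      corank (Y ∪ ⁅ e ⁆)         ≡⟨ cong (_+ (n ∸ c')) (∣p∪⁅x⁆∣≡1+∣p∣ e∉Y) ⟩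
      suc ∣ Y ∣ + (n ∸ c')       ≡⟨ +-suc ∣ Y ∣ _ ⟨
      ∣ Y ∣ + suc (n ∸ c')       ≤⟨ +-monoʳ-≤ ∣ Y ∣ (∸-monoʳ-< c<c' (∣p∣≤n (roots (⊤ ─ (Y ∪ ⁅ e ⁆))))) ⟩
      ∣ Y ∣ + (n ∸ c)            ∎
      where
      open ≤-Reasoning
      c<c' : c < c'
      c<c' = components-split {⊤ ─ Y} (Reach-mono (⊤─-antitone (p⊆p∪q ⁅ e ⁆)))
                                      (Reach-along (∈⊤─⁺ e∉Y) joins) u≁w

    nonbridge⇒corank-∪⁅⁆> : ∀ {u w} → e ∉ Y → Joins e u w → Reach G (⊤ ─ (Y ∪ ⁅ e ⁆)) u w →
                             corank Y < corank (Y ∪ ⁅ e ⁆)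
    nonbridge⇒corank-∪⁅⁆> e∉Y joins u~w = begin-strict
      ∣ Y ∣ + (n ∸ c)            <⟨ s≤s (+-monoʳ-≤ ∣ Y ∣ (∸-monoʳ-≤ n c'≤c)) ⟩
      suc ∣ Y ∣ + (n ∸ c')       ≡⟨ cong (_+ (n ∸ c')) (∣p∪⁅x⁆∣≡1+∣p∣ e∉Y) ⟨
      corank (Y ∪ ⁅ e ⁆)         ∎
      where
      open ≤-Reasoning
      c'≤c : c' ≤ c
      c'≤c = components-antitone {⊤ ─ (Y ∪ ⁅ e ⁆)}
               (Reach-bypass (⊤─p⊆⊤─[p∪⁅x⁆]∪⁅x⁆ Y) (Reach-endpoints joins u~w))

    corank-∪⁅⁆-dichotomy : ∀ {u w} → Joins e u w →
                           corank (Y ∪ ⁅ e ⁆) ≤ corank Y ⊎ (e ∉ Y × Reach G (⊤ ─ (Y ∪ ⁅ e ⁆)) u w)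
    corank-∪⁅⁆-dichotomy {u} {w} joins with e ∈? Y | Reach? (⊤ ─ (Y ∪ ⁅ e ⁆)) u w
    ... | yes e∈Y | _       = inj₁ (≤-reflexive (cong corank (p∪⁅x⁆≡p e∈Y)))
    ... | no e∉Y  | yes u~w = inj₂ (e∉Y , u~w)
    ... | no _    | no u≁w  = inj₁ (bridge⇒corank-∪⁅⁆≤ joins u≁w)

  -- Edge boundaries and the edges at a vertex

  ∈δ⁺ : ∀ {A e} → src G e ∈ A ⊎ tgt G e ∈ A → e ∈ δ G A
  ∈δ⁺ e∈ = ∈-tabulate⁺ (T-∨.from (Sum.map ∈⇒T-lookup ∈⇒T-lookup e∈))

  ∈δ⁻ : ∀ {A e} → e ∈ δ G A → src G e ∈ A ⊎ tgt G e ∈ A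
  ∈δ⁻ {A} {e} e∈ = Sum.map T-lookup⇒∈ T-lookup⇒∈ (T-∨.to {x = lookup A (src G e)} (∈-tabulate⁻ e∈))

  δ-mono : ∀ {A B} → A ⊆ B → δ G A ⊆ δ G B
  δ-mono A⊆B = ∈δ⁺ ∘ Sum.map A⊆B A⊆B ∘ ∈δ⁻

  δ-∅ : δ G ∅ ≡ ∅
  δ-∅ = ⊆-antisym (⊥-elim ∘ [ ∉⊥ , ∉⊥ ]′ ∘ ∈δ⁻) (⊆-min _)

  δ-∪ : ∀ A B → δ G (A ∪ B) ≡ δ G A ∪ δ G B
  δ-∪ A B = ⊆-antisym (λ e∈ → [ [ inˡ ∘ inj₁ , inʳ ∘ inj₁ ]′ ∘ x∈p∪q⁻ A B
                               , [ inˡ ∘ inj₂ , inʳ ∘ inj₂ ]′ ∘ x∈p∪q⁻ A B ]′ (∈δ⁻ e∈))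
                      ([ δ-mono {A} (p⊆p∪q B) , δ-mono {B} (q⊆p∪q A B) ]′ ∘ x∈p∪q⁻ _ _)
    where
    inˡ : ∀ {e} → src G e ∈ A ⊎ tgt G e ∈ A → e ∈ δ G A ∪ δ G B
    inˡ = p⊆p∪q _ ∘ ∈δ⁺
    inʳ : ∀ {e} → src G e ∈ B ⊎ tgt G e ∈ B → e ∈ δ G A ∪ δ G B
    inʳ = q⊆p∪q _ _ ∘ ∈δ⁺

  Incident⇒∈δ⁅⁆ : ∀ {e v} → Incident e v → e ∈ δ G ⁅ v ⁆
  Incident⇒∈δ⁅⁆ (inj₁ refl) = ∈δ⁺ (inj₁ (x∈⁅x⁆ _))
  Incident⇒∈δ⁅⁆ (inj₂ refl) = ∈δ⁺ (inj₂ (x∈⁅x⁆ _))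

  ∈δ⁅⁆⇒Incident : ∀ {e v} → e ∈ δ G ⁅ v ⁆ → Incident e v
  ∈δ⁅⁆⇒Incident {v = v} = Sum.map (x∈⁅y⁆⇒x≡y v) (x∈⁅y⁆⇒x≡y v) ∘ ∈δ⁻

  Joins⇒∈δ : ∀ {A e v a} → Joins e v a → a ∈ A → e ∈ δ G A
  Joins⇒∈δ (inj₁ (_ , refl)) a∈A = ∈δ⁺ (inj₂ a∈A)
  Joins⇒∈δ (inj₂ (refl , _)) a∈A = ∈δ⁺ (inj₁ a∈A)

  isolated-outside-δ : ∀ {A v} → v ∈ A → Isolated (⊤ ─ δ G A) v
  isolated-outside-δ v∈A = loops-only⇒isolated λ e∈ incident →
    ⊥-elim (∈⊤─⁻ e∈ (∈δ⁺ (Sum.map (λ { refl → v∈A }) (λ { refl → v∈A }) incident)))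

  loopsAt : Fin n → Subset m
  loopsAt v = tabulate (λ e → ⌊ src G e ≟ v ⌋) ∩ tabulate (λ e → ⌊ tgt G e ≟ v ⌋)

  degree≡∣δ⁅⁆∣+∣loopsAt∣ : ∀ v → degree G v ≡ ∣ δ G ⁅ v ⁆ ∣ + ∣ loopsAt v ∣
  degree≡∣δ⁅⁆∣+∣loopsAt∣ v =
    trans (sym (∣p∪q∣+∣p∩q∣≡∣p∣+∣q∣ Sᵥ Tᵥ)) (cong (λ p → ∣ p ∣ + ∣ Sᵥ ∩ Tᵥ ∣) Sᵥ∪Tᵥ≡δ⁅v⁆)
    where
    Sᵥ Tᵥ : Subset m
    Sᵥ = tabulate (λ e → ⌊ src G e ≟ v ⌋)
    Tᵥ = tabulate (λ e → ⌊ tgt G e ≟ v ⌋)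
    Sᵥ∪Tᵥ≡δ⁅v⁆ : Sᵥ ∪ Tᵥ ≡ δ G ⁅ v ⁆
    Sᵥ∪Tᵥ≡δ⁅v⁆ = ⊆-antisym
      (Incident⇒∈δ⁅⁆ ∘ Sum.map (toWitness ∘ ∈-tabulate⁻) (toWitness ∘ ∈-tabulate⁻) ∘ x∈p∪q⁻ Sᵥ Tᵥ)
      (x∈p∪q⁺ ∘ Sum.map (∈-tabulate⁺ ∘ fromWitness) (∈-tabulate⁺ ∘ fromWitness) ∘ ∈δ⁅⁆⇒Incident)

  ∈loopsAt⁺ : ∀ {e v} → src G e ≡ v × tgt G e ≡ v → e ∈ loopsAt v
  ∈loopsAt⁺ {v = v} (s≡v , t≡v) =
    x∈p∩q⁺ ( ∈-tabulate⁺ {f = λ e → ⌊ src G e ≟ v ⌋} (fromWitness s≡v)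
           , ∈-tabulate⁺ {f = λ e → ⌊ tgt G e ≟ v ⌋} (fromWitness t≡v) )

  ∈loopsAt⁻ : ∀ {e v} → e ∈ loopsAt v → src G e ≡ v × tgt G e ≡ v
  ∈loopsAt⁻ e∈ = let s , t = x∈p∩q⁻ _ _ e∈ in toWitness (∈-tabulate⁻ s) , toWitness (∈-tabulate⁻ t)

  Joins⇒Incident : ∀ {e v a} → Joins e v a → Incident e v
  Joins⇒Incident = Sum.map proj₁ proj₂

  other-end : ∀ {e v} → Incident e v → ¬ (src G e ≡ v × tgt G e ≡ v) → ∃ λ x → Joins e v x × x ≢ v
  other-end (inj₁ refl) not-loop = _ , inj₁ (refl , refl) , λ t≡s → not-loop (refl , t≡s)
  other-end (inj₂ refl) not-loop = _ , inj₂ (refl , refl) , λ s≡t → not-loop (s≡t , refl)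

  record Star (v : Fin n) (e₀ : Fin m) : Set where
    field
      e₁ e₂  : Fin m
      x₁ x₂  : Fin n
      joins₁ : Joins e₁ v x₁
      joins₂ : Joins e₂ v x₂
      x₁≢v   : x₁ ≢ v
      x₂≢v   : x₂ ≢ v
      e₁≢e₂  : e₁ ≢ e₂
      δ⁅v⁆≡  : δ G ⁅ v ⁆ ≡ (⁅ e₀ ⁆ ∪ ⁅ e₁ ⁆) ∪ ⁅ e₂ ⁆

  module _ (trivalent : Trivalent G) (bridgeless : TwoEdgeConnected G)
           {v a e₀} (joins₀ : Joins e₀ v a) (a≢v : a ≢ v) where

    private
      E : Subset m
      E = δ G ⁅ v ⁆

      e₀∈E : e₀ ∈ E
      e₀∈E = Incident⇒∈δ⁅⁆ (Joins⇒Incident joins₀)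

      ∣E∣+∣loops∣≡3 : ∣ E ∣ + ∣ loopsAt v ∣ ≡ 3
      ∣E∣+∣loops∣≡3 = trans (sym (degree≡∣δ⁅⁆∣+∣loopsAt∣ v)) (trivalent v)

    -- A loop at v would leave e₀ as the only other edge at v, that is, as a bridge.
    no-loop : ∀ {ℓ} → ¬ (src G ℓ ≡ v × tgt G ℓ ≡ v)
    no-loop {ℓ} (s≡v , t≡v) = a≢v (isolated (proj₂ bridgeless e₀ v a))
      where
      ℓ≢e₀ : ℓ ≢ e₀
      ℓ≢e₀ refl = a≢v ([ (λ (_ , t≡a) → trans (sym t≡a) t≡v) , (λ (s≡a , _) → trans (sym s≡a) s≡v) ]′
                         joins₀)

      ℓ∈E-e₀ : ℓ ∈ E - e₀
      ℓ∈E-e₀ = x∈p∧x≢y⇒x∈p-y (Incident⇒∈δ⁅⁆ (inj₁ s≡v)) ℓ≢e₀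

      ∣E-e₀-ℓ∣≡0 : ∣ E - e₀ - ℓ ∣ ≡ 0
      ∣E-e₀-ℓ∣≡0 = m+1+n≡1⇒m≡0 _ (suc-injective (suc-injective (begin
        suc (suc ∣ E - e₀ - ℓ ∣) + suc ∣ loopsAt v - ℓ ∣
          ≡⟨ cong₂ _+_ (trans (∣p∣≡1+∣p-x∣ e₀∈E) (cong suc (∣p∣≡1+∣p-x∣ ℓ∈E-e₀)))
                       (∣p∣≡1+∣p-x∣ (∈loopsAt⁺ (s≡v , t≡v))) ⟨
        ∣ E ∣ + ∣ loopsAt v ∣
          ≡⟨ ∣E∣+∣loops∣≡3 ⟩
        3 ∎)))
        where open ≡-Reasoning

      only-e₀-ℓ : ∀ {e} → e ∈ E → e ≡ e₀ ⊎ e ≡ ℓ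
      only-e₀-ℓ {e} e∈E with e ≟ e₀ | e ≟ ℓ
      ... | yes e≡e₀ | _        = inj₁ e≡e₀
      ... | no _     | yes e≡ℓ  = inj₂ e≡ℓ
      ... | no e≢e₀  | no e≢ℓ   =
        ⊥-elim (∣p∣≡0⇒x∉p ∣E-e₀-ℓ∣≡0 (x∈p∧x≢y⇒x∈p-y (x∈p∧x≢y⇒x∈p-y e∈E e≢e₀) e≢ℓ))

      isolated : Isolated (⊤ - e₀) v
      isolated = loops-only⇒isolated λ e∈ incident → case only-e₀-ℓ (Incident⇒∈δ⁅⁆ incident) of λ where
        (inj₁ refl) → ⊥-elim (∈⊤─⁻ e∈ (x∈⁅x⁆ e₀))
        (inj₂ refl) → trans s≡v (sym t≡v)

    private
      ∣E-e₀∣≡2 : ∣ E - e₀ ∣ ≡ 2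
      ∣E-e₀∣≡2 = suc-injective (begin
        suc ∣ E - e₀ ∣             ≡⟨ ∣p∣≡1+∣p-x∣ e₀∈E ⟨
        ∣ E ∣                      ≡⟨ +-identityʳ ∣ E ∣ ⟨
        ∣ E ∣ + 0                  ≡⟨ cong (∣ E ∣ +_) ∣loops∣≡0 ⟨
        ∣ E ∣ + ∣ loopsAt v ∣      ≡⟨ ∣E∣+∣loops∣≡3 ⟩
        3                          ∎)
        where
        open ≡-Reasoning
        ∣loops∣≡0 : ∣ loopsAt v ∣ ≡ 0
        ∣loops∣≡0 = trans (cong ∣_∣ (Empty-unique (λ (ℓ , ℓ∈) → no-loop (∈loopsAt⁻ ℓ∈)))) (∣⊥∣≡0 m)

    star : Star v e₀
    star with ∣p∣≡1+j⇒∃x∈p {p = E - e₀} ∣E-e₀∣≡2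
    ... | e₁ , e₁∈E-e₀ , ∣E-e₀-e₁∣≡1 with ∣p∣≡1+j⇒∃x∈p {p = E - e₀ - e₁} ∣E-e₀-e₁∣≡1
    ...   | e₂ , e₂∈E-e₀-e₁ , ∣E-e₀-e₁-e₂∣≡0 = record
      { e₁ = e₁ ; e₂ = e₂ ; x₁ = proj₁ end₁ ; x₂ = proj₁ end₂
      ; joins₁ = proj₁ (proj₂ end₁) ; joins₂ = proj₁ (proj₂ end₂)
      ; x₁≢v = proj₂ (proj₂ end₁) ; x₂≢v = proj₂ (proj₂ end₂)
      ; e₁≢e₂ = λ e₁≡e₂ → proj₂ (x∈p-y⁻ (E - e₀) e₁ e₂∈E-e₀-e₁) (sym e₁≡e₂)
      ; δ⁅v⁆≡ = ⊆-antisym E⊆ ⊇E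
      }
      where
      e₁∈E : e₁ ∈ E
      e₁∈E = proj₁ (x∈p-y⁻ E e₀ e₁∈E-e₀)

      e₂∈E : e₂ ∈ E
      e₂∈E = proj₁ (x∈p-y⁻ E e₀ (proj₁ (x∈p-y⁻ (E - e₀) e₁ e₂∈E-e₀-e₁)))

      end₁ : ∃ λ x → Joins e₁ v x × x ≢ v
      end₁ = other-end (∈δ⁅⁆⇒Incident e₁∈E) no-loop

      end₂ : ∃ λ x → Joins e₂ v x × x ≢ v
      end₂ = other-end (∈δ⁅⁆⇒Incident e₂∈E) no-loop

      E⊆ : E ⊆ (⁅ e₀ ⁆ ∪ ⁅ e₁ ⁆) ∪ ⁅ e₂ ⁆
      E⊆ {e} e∈E with e ≟ e₀ | e ≟ e₁ | e ≟ e₂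
      ... | yes refl | _        | _        = x∈p∪q⁺ (inj₁ (x∈p∪q⁺ (inj₁ (x∈⁅x⁆ e₀))))
      ... | no _     | yes refl | _        = x∈p∪q⁺ (inj₁ (x∈p∪q⁺ (inj₂ (x∈⁅x⁆ e₁))))
      ... | no _     | no _     | yes refl = x∈p∪q⁺ (inj₂ (x∈⁅x⁆ e₂))
      ... | no e≢e₀  | no e≢e₁  | no e≢e₂  = ⊥-elim (∣p∣≡0⇒x∉p ∣E-e₀-e₁-e₂∣≡0
        (x∈p∧x≢y⇒x∈p-y (x∈p∧x≢y⇒x∈p-y (x∈p∧x≢y⇒x∈p-y e∈E e≢e₀) e≢e₁) e≢e₂))

      ⊇E : (⁅ e₀ ⁆ ∪ ⁅ e₁ ⁆) ∪ ⁅ e₂ ⁆ ⊆ E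
      ⊇E = [ [ x∈p⇒⁅x⁆⊆p e₀∈E , x∈p⇒⁅x⁆⊆p e₁∈E ]′ ∘ x∈p∪q⁻ ⁅ e₀ ⁆ ⁅ e₁ ⁆ , x∈p⇒⁅x⁆⊆p e₂∈E ]′
           ∘ x∈p∪q⁻ (⁅ e₀ ⁆ ∪ ⁅ e₁ ⁆) ⁅ e₂ ⁆

  -- The graph curve matroid

  ∈-subsets : ∀ {k} (p : Subset k) → p ∈ˡ subsets G k
  ∈-subsets []            = Any.here refl
  ∈-subsets (outside ∷ p) = ∈-++⁺ˡ (∈-map⁺ (outside ∷_) (∈-subsets p))
  ∈-subsets (inside ∷ p)  = ∈-++⁺ʳ (map (outside ∷_) (subsets G _)) (∈-map⁺ (inside ∷_) (∈-subsets p))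

  Dependent : Subset n → Set
  Dependent B = bondRank G (δ G B) ≤ ∣ B ∣

  IsCircuit : Subset n → Set
  IsCircuit C = T (circuitᵇ G C)

  Independent : Subset n → Set
  Independent I = T (independentᵇ G I)

  circuit⇒minimal-dependent : ∀ {C} → IsCircuit C →
    Nonempty C × Dependent C × (∀ {B} → B ⊂ C → Nonempty B → ¬ Dependent B)
  circuit⇒minimal-dependent {C} circuit with T-∧.to {x = ⌊ nonempty? C ⌋} circuit
  ... | nonempty , rest with T-∧.to {x = dependentᵇ G C} rest
  ...   | dependent , minimal = toWitness nonempty , ≤ᵇ⇒≤ _ _ dependent , not-dependent
    where
    not-dependent : ∀ {B} → B ⊂ C → Nonempty B → ¬ Dependent B
    not-dependent {B} B⊂C B≢∅ B-dependent =
      Equivalence.to T-not⇔¬T (All.lookup (all⁺ _ _ minimal) (∈-subsets B))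
        (T-∧.from ( fromWitness {a? = B ⊂? C} B⊂C
                  , T-∧.from (fromWitness {a? = nonempty? B} B≢∅ , ≤⇒≤ᵇ B-dependent) ))

  independent⁺ : ∀ {I} → (∀ {C} → C ⊆ I → ¬ IsCircuit C) → Independent I
  independent⁺ {I} no-circuit = all⁻ _ (All.universal free (subsets G n))
    where
    free : ∀ C → T (not (⌊ C ⊆? I ⌋ ∧ circuitᵇ G C))
    free C = Equivalence.from T-not⇔¬T λ t →
      let C⊆I , circuit = T-∧.to {x = ⌊ C ⊆? I ⌋} t in no-circuit (toWitness C⊆I) circuit

  independent⁻ : ∀ {I C} → Independent I → C ⊆ I → ¬ IsCircuit C
  independent⁻ {I} {C} independent C⊆I circuit =
    Equivalence.to T-not⇔¬T (All.lookup (all⁺ _ _ independent) (∈-subsets C))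
      (T-∧.from (fromWitness {a? = C ⊆? I} C⊆I , circuit))

  independent-∅ : Independent ∅
  independent-∅ = independent⁺ λ C⊆∅ circuit →
    let _ , x∈C = proj₁ (circuit⇒minimal-dependent circuit) in ∉⊥ (C⊆∅ x∈C)

  independent-∪⁅⁆ : ∀ {I v} → Independent I → (∀ {C} → C ⊆ I ∪ ⁅ v ⁆ → v ∈ C → ¬ IsCircuit C) →
                    Independent (I ∪ ⁅ v ⁆)
  independent-∪⁅⁆ {I} {v} independent no-circuit-through-v = independent⁺ λ {C} C⊆ → case v ∈? C of λ where
    (yes v∈C) → no-circuit-through-v C⊆ v∈C
    (no v∉C)  → independent⁻ independent λ x∈C →
      [ (λ x∈I → x∈I) , (λ x∈⁅v⁆ → ⊥-elim (v∉C (subst (_∈ C) (x∈⁅y⁆⇒x≡y v x∈⁅v⁆) x∈C))) ]′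
        (x∈p∪q⁻ I ⁅ v ⁆ (C⊆ x∈C))

  ∣∣≤rankM : ∀ {A I} → I ⊆ A → Independent I → ∣ I ∣ ≤ rankM G A
  ∣∣≤rankM {A} {I} I⊆A independent =
    foldr-preservesᵒ {P = ∣ I ∣ ≤_} (λ x y → [ m≤n⇒m≤n⊔o y , m≤n⇒m≤o⊔n x ]′) 0 _
      (inj₂ (Any.map⁺ (Any.map (λ { refl → ≤-reflexive (sym counted) }) (∈-subsets I))))
    where
    counted : (if ⌊ I ⊆? A ⌋ ∧ independentᵇ G I then ∣ I ∣ else 0) ≡ ∣ I ∣
    counted with I ⊆? A | independentᵇ G I | Equivalence.to T-≡ independent
    ... | yes _  | true  | _  = refl
    ... | yes _  | false | ()
    ... | no I⊈A | _     | _  = ⊥-elim (I⊈A I⊆A)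

  rankM<rankM : ∀ {A B} → (∀ {I} → I ⊆ A → Independent I → ∃ λ J → J ⊆ B × Independent J × ∣ I ∣ < ∣ J ∣) →
                rankM G A < rankM G B
  rankM<rankM {A} {B} extend =
    foldr-preservesᵇ {P = _< rankM G B} ⊔-pres-<m rankM-B-positive (All.map⁺ (All.universal below (subsets G n)))
    where
    below-rankM : ∀ {I} → I ⊆ A → Independent I → ∣ I ∣ < rankM G B
    below-rankM I⊆A independent =
      let _ , J⊆B , J-independent , ∣I∣<∣J∣ = extend I⊆A independent in
      <-≤-trans ∣I∣<∣J∣ (∣∣≤rankM J⊆B J-independent)

    rankM-B-positive : 0 < rankM G B
    rankM-B-positive = subst (_< rankM G B) (∣⊥∣≡0 n) (below-rankM (⊆-min A) independent-∅)

    below : ∀ I → (if ⌊ I ⊆? A ⌋ ∧ independentᵇ G I then ∣ I ∣ else 0) < rankM G B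
    below I with I ⊆? A | independentᵇ G I in independent
    ... | yes I⊆A | true  = below-rankM I⊆A (Equivalence.from T-≡ independent)
    ... | yes _   | false = rankM-B-positive
    ... | no _    | _     = rankM-B-positive

  rankM-∪⁅⁆ : ∀ {A v} → v ∉ A → (∀ {C} → C ⊆ A ∪ ⁅ v ⁆ → v ∈ C → ¬ IsCircuit C) →
              rankM G A < rankM G (A ∪ ⁅ v ⁆)
  rankM-∪⁅⁆ {A} {v} v∉A no-circuit-through-v = rankM<rankM λ {I} I⊆A independent →
    I ∪ ⁅ v ⁆ , ∪-monoˡ I⊆A ,
    independent-∪⁅⁆ independent (λ C⊆ → no-circuit-through-v (∪-monoˡ I⊆A ∘ C⊆)) ,
    ≤-reflexive (sym (∣p∪⁅x⁆∣≡1+∣p∣ (v∉A ∘ I⊆A)))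

-- Adding a neighbour of A

module AddVertex {n m} {G : Graph n m} (bridgeless : TwoEdgeConnected G)
         {A : Subset n} {v : Fin n} (v∉A : v ∉ A) {e₀ : Fin m} {a : Fin n}
         (a∈A : a ∈ A) (joins₀ : Joins G e₀ v a) (star : Star G v e₀) where

  open Star star

  private
    X X₁ X' : Subset m
    X  = δ G A
    X₁ = X ∪ ⁅ e₁ ⁆
    X' = X₁ ∪ ⁅ e₂ ⁆

    e₀∈X : e₀ ∈ X
    e₀∈X = Joins⇒∈δ G joins₀ a∈A

    δ-∪⁅v⁆ : ∀ B → δ G (B ∪ ⁅ v ⁆) ≡ ((δ G B ∪ ⁅ e₀ ⁆) ∪ ⁅ e₁ ⁆) ∪ ⁅ e₂ ⁆
    δ-∪⁅v⁆ B = begin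
      δ G (B ∪ ⁅ v ⁆)                        ≡⟨ δ-∪ G B ⁅ v ⁆ ⟩
      δ G B ∪ δ G ⁅ v ⁆                      ≡⟨ cong (δ G B ∪_) δ⁅v⁆≡ ⟩
      δ G B ∪ ((⁅ e₀ ⁆ ∪ ⁅ e₁ ⁆) ∪ ⁅ e₂ ⁆)    ≡⟨ ∪-assoc _ _ _ ⟨
      (δ G B ∪ (⁅ e₀ ⁆ ∪ ⁅ e₁ ⁆)) ∪ ⁅ e₂ ⁆    ≡⟨ cong (_∪ ⁅ e₂ ⁆) (∪-assoc _ _ _) ⟨
      ((δ G B ∪ ⁅ e₀ ⁆) ∪ ⁅ e₁ ⁆) ∪ ⁅ e₂ ⁆    ∎
      where open ≡-Reasoning

    δ[A∪⁅v⁆]≡X' : δ G (A ∪ ⁅ v ⁆) ≡ X'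
    δ[A∪⁅v⁆]≡X' = trans (δ-∪⁅v⁆ A) (cong (λ Y → (Y ∪ ⁅ e₁ ⁆) ∪ ⁅ e₂ ⁆) (p∪⁅x⁆≡p e₀∈X))

    v-isolated : Isolated G (⊤ ─ X') v
    v-isolated = subst (λ Y → Isolated G (⊤ ─ Y) v) δ[A∪⁅v⁆]≡X' (isolated-outside-δ G (q⊆p∪q A _ (x∈⁅x⁆ v)))

    corank-X'≤X₁ : corank G X' ≤ corank G X₁
    corank-X'≤X₁ = bridge⇒corank-∪⁅⁆≤ G joins₂ (x₂≢v ∘ v-isolated)

  corank-δ[A∪⁅v⁆]≤1+ : corank G (δ G (A ∪ ⁅ v ⁆)) ≤ suc (corank G (δ G A))
  corank-δ[A∪⁅v⁆]≤1+ rewrite δ[A∪⁅v⁆]≡X' = ≤-trans corank-X'≤X₁ (corank-∪⁅⁆≤1+ G)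

  module _ (e₁∉X : e₁ ∉ X) (e₂∉X : e₂ ∉ X) (x₂~x₁ : Reach G (⊤ ─ X') x₂ x₁) where

    private
      corank-gain : ∀ {Y} → Y ⊆ X → corank G Y < corank G ((Y ∪ ⁅ e₁ ⁆) ∪ ⁅ e₂ ⁆)
      corank-gain {Y} Y⊆X = <-≤-trans (nonbridge⇒corank-∪⁅⁆> G (e₁∉X ∘ Y⊆X) joins₁ v~x₁) (corank-mono-∪⁅⁆ G)
        where
        e₂∉Y∪⁅e₁⁆ : e₂ ∉ Y ∪ ⁅ e₁ ⁆
        e₂∉Y∪⁅e₁⁆ = [ e₂∉X ∘ Y⊆X , e₁≢e₂ ∘ sym ∘ x∈⁅y⁆⇒x≡y e₁ ]′ ∘ x∈p∪q⁻ Y ⁅ e₁ ⁆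

        v~x₁ : Reach G (⊤ ─ (Y ∪ ⁅ e₁ ⁆)) v x₁
        v~x₁ = Reach-trans G (Reach-along G (∈⊤─⁺ e₂∉Y∪⁅e₁⁆) joins₂)
                             (Reach-mono G (⊤─-antitone (p⊆p∪q ⁅ e₂ ⁆ ∘ ∪-monoˡ Y⊆X)) x₂~x₁)

    module _ {C} (C⊆A∪⁅v⁆ : C ⊆ A ∪ ⁅ v ⁆) (v∈C : v ∈ C) where

      private
        B Y₀ : Subset _
        B  = C - v
        Y₀ = δ G B ∪ ⁅ e₀ ⁆

        B⊆A : B ⊆ A
        B⊆A x∈B = let x∈C , x≢v = x∈p-y⁻ C v x∈B in
          [ (λ x∈A → x∈A) , ⊥-elim ∘ x≢v ∘ x∈⁅y⁆⇒x≡y v ]′ (x∈p∪q⁻ A ⁅ v ⁆ (C⊆A∪⁅v⁆ x∈C))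

        ∣C∣≡1+∣B∣ : ∣ C ∣ ≡ suc ∣ B ∣
        ∣C∣≡1+∣B∣ = ∣p∣≡1+∣p-x∣ v∈C

        corank-Y₀<δC : corank G Y₀ < corank G (δ G C)
        corank-Y₀<δC = subst (λ Z → corank G Y₀ < corank G Z)
          (sym (trans (cong (δ G) (p≡p-x∪⁅x⁆ v∈C)) (δ-∪⁅v⁆ B)))
          (corank-gain ([ δ-mono G B⊆A , x∈p⇒⁅x⁆⊆p e₀∈X ]′ ∘ x∈p∪q⁻ (δ G B) ⁅ e₀ ⁆))

      dependent⇒rest-dependent : Dependent G C → Dependent G (C - v)
      dependent⇒rest-dependent C-dependent = begin
        corank G (δ G B) ∸ cycleRank G ⊤
          ≤⟨ <⇒∸≤pred∸ (cycleRank G ⊤) (≤-<-trans (corank-mono-∪⁅⁆ G) corank-Y₀<δC) ⟩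
        pred (corank G (δ G C) ∸ cycleRank G ⊤)
          ≤⟨ pred-mono-≤ C-dependent ⟩
        pred ∣ C ∣
          ≡⟨ cong pred ∣C∣≡1+∣B∣ ⟩
        ∣ B ∣
          ∎
        where open ≤-Reasoning

      rest-empty⇒¬dependent : C - v ≡ ∅ → ¬ Dependent G C
      rest-empty⇒¬dependent B≡∅ C-dependent = <⇒≱ (s≤s ≤-refl) (begin
        2                                        ≤⟨ m+n≤o⇒m≤o∸n 2 (begin
          2 + cycleRank G ⊤                        ≡⟨ cong (2 +_) (corank-∅ G) ⟨
          2 + corank G ∅                           ≤⟨ s≤s corank-∅<Y₀ ⟩
          suc (corank G Y₀)                        ≤⟨ corank-Y₀<δC ⟩
          corank G (δ G C)                         ∎) ⟩
        bondRank G (δ G C)                       ≤⟨ C-dependent ⟩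
        ∣ C ∣                                    ≡⟨ trans ∣C∣≡1+∣B∣ (cong (suc ∘ ∣_∣) B≡∅) ⟩
        suc ∣ ∅ {n = n} ∣                        ≡⟨ cong suc (∣⊥∣≡0 n) ⟩
        1                                        ∎)
        where
        open ≤-Reasoning
        Y₀≡∅∪⁅e₀⁆ : Y₀ ≡ ∅ ∪ ⁅ e₀ ⁆
        Y₀≡∅∪⁅e₀⁆ = cong (_∪ ⁅ e₀ ⁆) (trans (cong (δ G) B≡∅) (δ-∅ G))
        corank-∅<Y₀ : corank G ∅ < corank G Y₀
        corank-∅<Y₀ = subst (λ Z → corank G ∅ < corank G Z) (sym Y₀≡∅∪⁅e₀⁆)
          (nonbridge⇒corank-∪⁅⁆> G ∉⊥ joins₀
            (subst (λ Z → Reach G (⊤ ─ Z) v a) (sym (∪-identityˡ ⁅ e₀ ⁆)) (proj₂ bridgeless e₀ v a)))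

    no-circuit-through-v : ∀ {C} → C ⊆ A ∪ ⁅ v ⁆ → v ∈ C → ¬ IsCircuit G C
    no-circuit-through-v {C} C⊆A∪⁅v⁆ v∈C circuit with circuit⇒minimal-dependent G circuit | nonempty? (C - v)
    ... | _ , C-dependent , minimal | yes rest≢∅ =
      minimal (p─q⊆p C ⁅ v ⁆ , v , v∈C , λ v∈C-v → proj₂ (x∈p-y⁻ C v v∈C-v) refl) rest≢∅
              (dependent⇒rest-dependent C⊆A∪⁅v⁆ v∈C C-dependent)
    ... | _ , C-dependent , _ | no rest≡∅ = rest-empty⇒¬dependent C⊆A∪⁅v⁆ v∈C (Empty-unique rest≡∅) C-dependent

  corank-δ[A∪⁅v⁆]≰⇒rankM< : ¬ (corank G (δ G (A ∪ ⁅ v ⁆)) ≤ corank G (δ G A)) → rankM G A < rankM G (A ∪ ⁅ v ⁆)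
  corank-δ[A∪⁅v⁆]≰⇒rankM< X'≰X with corank-∪⁅⁆-dichotomy G {Y = X} {e = e₁} joins₁
  ... | inj₁ X₁≤X =
    ⊥-elim (X'≰X (subst (λ Z → corank G Z ≤ corank G X) (sym δ[A∪⁅v⁆]≡X') (≤-trans corank-X'≤X₁ X₁≤X)))
  ... | inj₂ (e₁∉X , v~x₁) with Reach-pendant G (⊤─p⊆⊤─[p∪⁅x⁆]∪⁅x⁆ X₁) v-isolated joins₂ v~x₁
  ...   | inj₁ x₁≡v  = ⊥-elim (x₁≢v x₁≡v)
  ...   | inj₂ x₂~x₁ = rankM-∪⁅⁆ G v∉A (no-circuit-through-v e₁∉X e₂∉X x₂~x₁)
    where
    e₂∉X : e₂ ∉ X
    e₂∉X e₂∈X =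
      x₁≢v (v-isolated (subst (λ Z → Reach G (⊤ ─ Z) v x₁) (sym (p∪⁅x⁆≡p (p⊆p∪q ⁅ e₁ ⁆ e₂∈X))) v~x₁))

lemma4p2 : ∀ {n m} (G : Graph n m) → Trivalent G → TwoEdgeConnected G →
    (A : Subset n) → InducedConnected G A →
    (v : Fin n) → v ∉ A → AdjacentTo G v A →
    (bondRank G (δ G (A ∪ ⁅ v ⁆)) ≤ bondRank G (δ G A) + 1)
    × (bondRank G (δ G (A ∪ ⁅ v ⁆)) ≡ bondRank G (δ G A) + 1 →
       rankM G A < rankM G (A ∪ ⁅ v ⁆))
lemma4p2 G trivalent bridgeless A _ v v∉A (e₀ , a , a∈A , joins₀) = bondRank-step , bondRank-jump⇒rankM<
  where
  a≢v : a ≢ v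
  a≢v refl = v∉A a∈A

  open AddVertex bridgeless v∉A a∈A joins₀ (star G trivalent bridgeless joins₀ a≢v)

  K : ℕ
  K = cycleRank G ⊤

  bondRank-step : bondRank G (δ G (A ∪ ⁅ v ⁆)) ≤ bondRank G (δ G A) + 1
  bondRank-step = begin
    corank G (δ G (A ∪ ⁅ v ⁆)) ∸ K  ≤⟨ ∸-monoˡ-≤ K corank-δ[A∪⁅v⁆]≤1+ ⟩
    suc (corank G (δ G A)) ∸ K      ≤⟨ ∸-suc-≤ _ K ⟩
    suc (corank G (δ G A) ∸ K)      ≡⟨ +-comm 1 _ ⟩
    bondRank G (δ G A) + 1          ∎
    where open ≤-Reasoning

  bondRank-jump⇒rankM< : bondRank G (δ G (A ∪ ⁅ v ⁆)) ≡ bondRank G (δ G A) + 1 →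
                         rankM G A < rankM G (A ∪ ⁅ v ⁆)
  bondRank-jump⇒rankM< jump = corank-δ[A∪⁅v⁆]≰⇒rankM< λ corank≤ →
    m+1+n≰m (bondRank G (δ G A)) (subst (_≤ bondRank G (δ G A)) jump (∸-monoˡ-≤ K corank≤))
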